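{- Let $t_c,t_m$ be positive integers with $t_c< t_m$. For every integer $R\ge t_c+t_m$, $N^*(R)=N^*(R-t_c)+N^*(R-t_c-t_m)$.
   Context: Token Network model: an undirected graph $G$ with integers $t_c,t_m$ (the smaller dividing the larger); synchronous rounds; each node starts with one token. A non-busy node holding $\ge1$ token may communicate (busy $t_m$ rounds, then one token is delivered to a neighbor); a non-busy node holding $\ge 2$ tokens may compute (busy $t_c$ rounds, then two of its tokens are replaced by one). A node may receive from several neighbors in one round. A schedule is valid if all actions are legal and at its end exactly one token remains; \textsc{Token Computation} asks for a valid schedule. $N^*(R)$ denotes the size of the largest complete graph $K_m$ such that \textsc{Token Computation} on $(K_m,t_c,t_m)$ can be solved by a valid schedule of length $R$. -}

module Defs where

open import Data.Nat using (ℕ; zero; suc; _+_; _*_; _∸_; _≤_; _<_)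
open import Data.Fin using (Fin) renaming (zero to fzero; suc to fsuc)
open import Data.Fin.Properties using () renaming (_≟_ to _≟F_)
open import Data.Nat.Properties using (_≟_)
open import Data.Product using (_×_; Σ)
open import Relation.Binary.PropositionalEquality using (_≡_; _≢_)
open import Relation.Nullary using (¬_; yes; no)

-- Token Network model specialised to the complete graph K_m,
-- nodes are Fin m, parameters tc (computation time), tm (communication time).

data Act (m : ℕ) : Set where
  idle : Act m
  send : Fin m → Act m   -- communicate: send one token to the given node
  comp : Act m           -- compute: combine two tokens into one

-- A schedule assigns to every node and every round (0,1,2,...) the action
-- the node starts in that round.
Schedule : ℕ → Set
Schedule m = Fin m → ℕ → Act m

sumFin : (m : ℕ) → (Fin m → ℕ) → ℕ
sumFin zero    f = 0
sumFin (suc m) f = f fzero + sumFin m (λ i → f (fsuc i))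

sumBelow : ℕ → (ℕ → ℕ) → ℕ
sumBelow zero    f = 0
sumBelow (suc t) f = sumBelow t f + f t

module Model (tc tm : ℕ) {m : ℕ} (σ : Schedule m) where

  dur : Act m → ℕ
  dur idle     = 0
  dur (send _) = tm
  dur comp     = tc

  spent : Act m → ℕ
  spent idle     = 0
  spent (send _) = 1
  spent comp     = 2

  -- is the action a send of a token to node v starting in round s and
  -- delivered at the start of round t (i.e. s + tm ≡ t)?
  sendArrives : Fin m → ℕ → ℕ → Act m → ℕ
  sendArrives v s t idle     = 0
  sendArrives v s t comp     = 0
  sendArrives v s t (send w) with w ≟F v | s + tm ≟ t
  ... | yes _ | yes _ = 1
  ... | _     | _     = 0

  compArrives : ℕ → ℕ → Act m → ℕ
  compArrives s t comp with s + tc ≟ t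
  ... | yes _ = 1
  ... | no  _ = 0
  compArrives s t _ = 0

  -- tokens becoming available at node v at the start of round t
  -- (deliveries of communications and results of computations that finish
  -- at the end of round t-1)
  arrivals : Fin m → ℕ → ℕ
  arrivals v t =
      sumFin m (λ u → sumBelow t (λ s → sendArrives v s t (σ u s)))
    + sumBelow t (λ s → compArrives s t (σ v s))

  tokens : Fin m → ℕ → ℕ
  tokens v zero    = 1
  tokens v (suc t) = (tokens v t ∸ spent (σ v t)) + arrivals v (suc t)

  record Valid (R : ℕ) : Set where
    field
      -- communication only to a neighbour (K_m has no loops)
      neighbour : ∀ v t w → σ v t ≡ send w → w ≢ v
      enough    : ∀ v t → spent (σ v t) ≤ tokens v t
      notBusy   : ∀ v s t → s < t → σ v s ≢ idle → σ v t ≢ idle →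
                  s + dur (σ v s) ≤ t
      finished  : ∀ v t → σ v t ≢ idle → t + dur (σ v t) ≤ R
      oneLeft   : sumFin m (λ v → tokens v R) ≡ 1

Solvable : (tc tm m R : ℕ) → Set
Solvable tc tm m R = Σ (Schedule m) (λ σ → Model.Valid tc tm σ R)

-- n = N*(R): the largest m such that K_m is solvable in R rounds
IsNStar : (tc tm R n : ℕ) → Set
IsNStar tc tm R n = Solvable tc tm n R × (∀ m → Solvable tc tm m R → m ≤ n)

-- N*(R) = F R, where F R = 1 for R < tc + tm and F R = F (R ∸ tc) + F (R ∸ tc ∸ tm)
-- otherwise, so the recursion of the theorem is that of F.
-- Lower bound: run an optimal schedule for R ∸ tc on F (R ∸ tc) nodes next to one for
-- R ∸ tc ∸ tm on F (R ∸ tc ∸ tm) nodes; the last token of the second group is sent at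
-- R ∸ tc ∸ tm to the node holding the last token of the first group at R ∸ tc, which
-- combines the two in one final computation.
-- Upper bound: a potential that starts at m, never decreases and is at most F R at the end.
-- At round t an idle node holding k ≥ 1 tokens is worth F t + (k − 1) F (t ∸ tm): one token
-- may stay, the others must first travel. A node computing since s is worth F (s + tc) plus
-- F (t ∸ tm) per held token, and a message sent at s is worth F s until it lands. Starting
-- a computation at t trades F t + F (t ∸ tm) for F (t + tc), an equality by the recursion
-- because no node holds two tokens before round tm; all other moves only let values grow.

module Submission where

open import Defs
open import Data.Nat using (ℕ; _+_; _∸_; _≤_; _<_)
open import Data.Nat.Divisibility using (_∣_)
open import Data.Product using (_×_; ∃; ∃-syntax)

open import Data.Empty using (⊥-elim)
open import Data.Fin using (Fin; _↑ˡ_; _↑ʳ_; splitAt) renaming (zero to fzero; suc to fsuc)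
open import Data.Fin.Properties
  using (↑ˡ-injective; ↑ʳ-injective; splitAt-↑ˡ; splitAt-↑ʳ; splitAt⁻¹-↑ˡ; splitAt⁻¹-↑ʳ)
  renaming (_≟_ to _≟F_; suc-injective to fsuc-injective)
open import Data.Nat
open import Data.Nat.Induction using (<-wellFounded; <-rec)
open import Data.Nat.Properties
open import Data.Product using (Σ; _,_; proj₁; proj₂)
open import Data.Sum using (_⊎_; inj₁; inj₂; [_,_]′)
open import Function using (_∘_)
open import Induction.WellFounded using (WfRec; module FixPoint)
open import Relation.Binary using (tri<; tri≈; tri>)
open import Relation.Binary.PropositionalEquality
open import Relation.Nullary using (¬_; Dec; yes; no)
open import Relation.Nullary.Decidable using (_×-dec_)

open import Algebra.Properties.CommutativeSemigroup +-commutativeSemigroup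
  using (interchange; x∙yz≈xz∙y; xy∙z≈xz∙y)
open import Algebra.Properties.Semiring.Sum +-*-semiring
  using (sum; ∑-distrib-+; ∑-comm; *-distribʳ-sum; sum-replicate-zero)

sumFin≡sum : ∀ m (f : Fin m → ℕ) → sumFin m f ≡ sum f
sumFin≡sum zero    f = refl
sumFin≡sum (suc m) f = cong (f fzero +_) (sumFin≡sum m (f ∘ fsuc))

sumFin-cong : ∀ m {f g : Fin m → ℕ} → (∀ i → f i ≡ g i) → sumFin m f ≡ sumFin m g
sumFin-cong zero    f≗g = refl
sumFin-cong (suc m) f≗g = cong₂ _+_ (f≗g fzero) (sumFin-cong m (f≗g ∘ fsuc))

sumFin-mono-≤ : ∀ m {f g : Fin m → ℕ} → (∀ i → f i ≤ g i) → sumFin m f ≤ sumFin m g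
sumFin-mono-≤ zero    f≤g = z≤n
sumFin-mono-≤ (suc m) f≤g = +-mono-≤ (f≤g fzero) (sumFin-mono-≤ m (f≤g ∘ fsuc))

sumFin-zero : ∀ m {f : Fin m → ℕ} → (∀ i → f i ≡ 0) → sumFin m f ≡ 0
sumFin-zero m f≗0 = trans (sumFin-cong m f≗0) (trans (sumFin≡sum m _) (sum-replicate-zero m))

sumFin-one : ∀ m → sumFin m (λ _ → 1) ≡ m
sumFin-one zero    = refl
sumFin-one (suc m) = cong suc (sumFin-one m)

sumFin-distrib-+ : ∀ m (f g : Fin m → ℕ) → sumFin m (λ i → f i + g i) ≡ sumFin m f + sumFin m g
sumFin-distrib-+ m f g = begin
  sumFin m (λ i → f i + g i) ≡⟨ sumFin≡sum m _ ⟩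
  sum (λ i → f i + g i)      ≡⟨ ∑-distrib-+ f g ⟩
  sum f + sum g              ≡⟨ sym (cong₂ _+_ (sumFin≡sum m f) (sumFin≡sum m g)) ⟩
  sumFin m f + sumFin m g    ∎
  where open ≡-Reasoning

sumFin-distribʳ-* : ∀ m (f : Fin m → ℕ) c → sumFin m f * c ≡ sumFin m (λ i → f i * c)
sumFin-distribʳ-* m f c = begin
  sumFin m f * c             ≡⟨ cong (_* c) (sumFin≡sum m f) ⟩
  sum f * c                  ≡⟨ *-distribʳ-sum c f ⟩
  sum (λ i → f i * c)        ≡⟨ sym (sumFin≡sum m _) ⟩
  sumFin m (λ i → f i * c)   ∎
  where open ≡-Reasoning

sumFin-comm : ∀ m n (f : Fin m → Fin n → ℕ) →
              sumFin m (λ i → sumFin n (f i)) ≡ sumFin n (λ j → sumFin m (λ i → f i j))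
sumFin-comm m n f = begin
  sumFin m (λ i → sumFin n (f i))          ≡⟨ sumFin-cong m (λ i → sumFin≡sum n (f i)) ⟩
  sumFin m (λ i → sum (f i))               ≡⟨ sumFin≡sum m _ ⟩
  sum (λ i → sum (f i))                    ≡⟨ ∑-comm f ⟩
  sum (λ j → sum (λ i → f i j))            ≡⟨ sym (sumFin≡sum n _) ⟩
  sumFin n (λ j → sum (λ i → f i j))       ≡⟨ sumFin-cong n (λ j → sym (sumFin≡sum m _)) ⟩
  sumFin n (λ j → sumFin m (λ i → f i j))  ∎
  where open ≡-Reasoning

sumFin-++ : ∀ a b (f : Fin (a + b) → ℕ) →
            sumFin (a + b) f ≡ sumFin a (λ i → f (i ↑ˡ b)) + sumFin b (λ j → f (a ↑ʳ j))
sumFin-++ zero    b f = refl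
sumFin-++ (suc a) b f = trans (cong (f fzero +_) (sumFin-++ a b (f ∘ fsuc))) (sym (+-assoc (f fzero) _ _))

sumFin-single : ∀ m (f : Fin m → ℕ) h → (∀ i → i ≢ h → f i ≡ 0) → sumFin m f ≡ f h
sumFin-single (suc m) f fzero    others = trans (cong (f fzero +_) (sumFin-zero m (λ i → others (fsuc i) (λ ())))) (+-identityʳ _)
sumFin-single (suc m) f (fsuc h) others = trans (cong (_+ sumFin m (f ∘ fsuc)) (others fzero (λ ())))
  (sumFin-single m (f ∘ fsuc) h (λ i i≢h → others (fsuc i) (i≢h ∘ fsuc-injective)))

sumFin≡0⇒≡0 : ∀ m (f : Fin m → ℕ) → sumFin m f ≡ 0 → ∀ i → f i ≡ 0
sumFin≡0⇒≡0 (suc m) f eq fzero    = m+n≡0⇒m≡0 (f fzero) eq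
sumFin≡0⇒≡0 (suc m) f eq (fsuc i) = sumFin≡0⇒≡0 m (f ∘ fsuc) (m+n≡0⇒n≡0 (f fzero) eq) i

sumFin≡1⇒single : ∀ m (f : Fin m → ℕ) → sumFin m f ≡ 1 →
                  Σ (Fin m) λ h → f h ≡ 1 × (∀ i → i ≢ h → f i ≡ 0)
sumFin≡1⇒single (suc m) f eq with f fzero in f0
... | zero with sumFin≡1⇒single m (f ∘ fsuc) eq
...   | h , fh≡1 , others = fsuc h , fh≡1 , λ where
          fzero    _   → f0
          (fsuc i) i≢h → others i (i≢h ∘ cong fsuc)
sumFin≡1⇒single (suc m) f eq | suc zero = fzero , f0 , λ where
          fzero    i≢0 → ⊥-elim (i≢0 refl)
          (fsuc i) _   → sumFin≡0⇒≡0 m (f ∘ fsuc) (suc-injective eq) i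
sumFin≡1⇒single (suc m) f eq | suc (suc _) with () ← suc-injective eq

sumBelow-cong : ∀ n {f g : ℕ → ℕ} → (∀ s → s < n → f s ≡ g s) → sumBelow n f ≡ sumBelow n g
sumBelow-cong zero    f≗g = refl
sumBelow-cong (suc n) f≗g = cong₂ _+_ (sumBelow-cong n (λ s s<n → f≗g s (m<n⇒m<1+n s<n))) (f≗g n ≤-refl)

sumBelow-zero : ∀ n {f : ℕ → ℕ} → (∀ s → s < n → f s ≡ 0) → sumBelow n f ≡ 0
sumBelow-zero zero    f≗0 = refl
sumBelow-zero (suc n) f≗0 = cong₂ _+_ (sumBelow-zero n (λ s s<n → f≗0 s (m<n⇒m<1+n s<n))) (f≗0 n ≤-refl)

sumBelow-single : ∀ n {f : ℕ → ℕ} s₀ → s₀ < n → (∀ s → s < n → s ≢ s₀ → f s ≡ 0) → sumBelow n f ≡ f s₀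
sumBelow-single (suc n) {f} s₀ s₀<1+n others with s₀ ≟ n
... | yes refl = cong (_+ f n) (sumBelow-zero n (λ s s<n → others s (m<n⇒m<1+n s<n) (<⇒≢ s<n)))
... | no s₀≢n  = trans (cong₂ _+_ (sumBelow-single n s₀ (≤∧≢⇒< (≤-pred s₀<1+n) s₀≢n) (λ s s<n → others s (m<n⇒m<1+n s<n)))
                                  (others n ≤-refl (s₀≢n ∘ sym)))
                       (+-identityʳ (f s₀))

sumBelow-distrib-+ : ∀ n (f g : ℕ → ℕ) → sumBelow n (λ s → f s + g s) ≡ sumBelow n f + sumBelow n g
sumBelow-distrib-+ zero    f g = refl
sumBelow-distrib-+ (suc n) f g = trans (cong (_+ (f n + g n)) (sumBelow-distrib-+ n f g))
                                       (interchange (sumBelow n f) (sumBelow n g) (f n) (g n))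

sumBelow-distribʳ-* : ∀ n (f : ℕ → ℕ) c → sumBelow n f * c ≡ sumBelow n (λ s → f s * c)
sumBelow-distribʳ-* zero    f c = refl
sumBelow-distribʳ-* (suc n) f c = trans (*-distribʳ-+ c (sumBelow n f) (f n)) (cong (_+ f n * c) (sumBelow-distribʳ-* n f c))

sumFin-sumBelow-comm : ∀ m n (f : Fin m → ℕ → ℕ) →
                       sumFin m (λ i → sumBelow n (f i)) ≡ sumBelow n (λ s → sumFin m (λ i → f i s))
sumFin-sumBelow-comm zero    n f = sym (sumBelow-zero n (λ _ _ → refl))
sumFin-sumBelow-comm (suc m) n f = trans (cong (sumBelow n (f fzero) +_) (sumFin-sumBelow-comm m n (f ∘ fsuc)))
                                         (sym (sumBelow-distrib-+ n (f fzero) _))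

when : {P : Set} → Dec P → ℕ → ℕ
when (yes _) x = x
when (no _)  _ = 0

when-yes : {P : Set} (d : Dec P) {x : ℕ} → P → when d x ≡ x
when-yes (yes _) _ = refl
when-yes (no ¬p) p = ⊥-elim (¬p p)

when-no : {P : Set} (d : Dec P) {x : ℕ} → ¬ P → when d x ≡ 0
when-no (yes p) ¬p = ⊥-elim (¬p p)
when-no (no _)  _  = refl

transfer-≤ : ∀ {n₀ n₁ o₀ o₁ s d} → n₀ + d ≤ n₁ + s → o₀ + s ≡ o₁ + d → n₀ + o₀ ≤ n₁ + o₁
transfer-≤ {n₀} {n₁} {o₀} {o₁} {s} {d} nodes flow = +-cancelʳ-≤ s _ _ (begin
  n₀ + o₀ + s     ≡⟨ +-assoc n₀ o₀ s ⟩
  n₀ + (o₀ + s)   ≡⟨ cong (n₀ +_) flow ⟩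
  n₀ + (o₁ + d)   ≡⟨ x∙yz≈xz∙y n₀ o₁ d ⟩
  n₀ + d + o₁     ≤⟨ +-monoˡ-≤ o₁ nodes ⟩
  n₁ + s + o₁     ≡⟨ xy∙z≈xz∙y n₁ s o₁ ⟩
  n₁ + o₁ + s     ∎)
  where open ≤-Reasoning

module Growth (tc tm : ℕ) (0<tc : 0 < tc) where

  tc≤⇒∸tc< : ∀ {n} → tc ≤ n → n ∸ tc < n
  tc≤⇒∸tc< tc≤n = ∸-monoʳ-< 0<tc tc≤n

  tc+tm≤⇒∸tc< : ∀ {n} → tc + tm ≤ n → n ∸ tc < n
  tc+tm≤⇒∸tc< le = tc≤⇒∸tc< (≤-trans (m≤m+n tc tm) le)

  tc+tm≤⇒∸tc∸tm< : ∀ {n} → tc + tm ≤ n → n ∸ tc ∸ tm < n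
  tc+tm≤⇒∸tc∸tm< le = ≤-<-trans (m∸n≤m _ tm) (tc+tm≤⇒∸tc< le)

  F-step : ∀ n → WfRec _<_ (λ _ → ℕ) n → ℕ
  F-step n F< with tc + tm ≤? n
  ... | yes le = F< (tc+tm≤⇒∸tc< le) + F< (tc+tm≤⇒∸tc∸tm< le)
  ... | no  _  = 1

  -- Opaque, so that with-abstractions on tc + tm ≤? n cannot reach into the unfolding of F.
  opaque
    F : ℕ → ℕ
    F = <-rec (λ _ → ℕ) F-step

    F-unfold : ∀ n → F n ≡ F-step n (λ {k} _ → F k)
    F-unfold n = FixPoint.unfold-wfRec <-wellFounded (λ _ → ℕ) F-step F-step-cong
      where
      F-step-cong : ∀ n {F< F<′ : WfRec _<_ (λ _ → ℕ) n} → (∀ {k} k<n → F< {k} k<n ≡ F<′ k<n) →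
                    F-step n F< ≡ F-step n F<′
      F-step-cong n eq with tc + tm ≤? n
      ... | yes le = cong₂ _+_ (eq _) (eq _)
      ... | no  _  = refl

  F-base : ∀ n → n < tc + tm → F n ≡ 1
  F-base n n< with tc + tm ≤? n | F-unfold n
  ... | yes le | _  = ⊥-elim (<⇒≱ n< le)
  ... | no  _  | eq = eq

  F-rec : ∀ n → tc + tm ≤ n → F n ≡ F (n ∸ tc) + F (n ∸ tc ∸ tm)
  F-rec n le with tc + tm ≤? n | F-unfold n
  ... | yes _  | eq = eq
  ... | no  ≰  | _  = ⊥-elim (≰ le)

  F-positive : ∀ n → 1 ≤ F n
  F-positive = <-rec _ go
    where
    go : ∀ n → WfRec _<_ (λ k → 1 ≤ F k) n → 1 ≤ F n
    go n IH with tc + tm ≤? n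
    ... | yes le = ≤-trans (IH (tc+tm≤⇒∸tc< le)) (≤-trans (m≤m+n (F (n ∸ tc)) _) (≤-reflexive (sym (F-rec n le))))
    ... | no  ≰  = ≤-reflexive (sym (F-base n (≰⇒> ≰)))

  F-suc : ∀ n → F n ≤ F (suc n)
  F-suc = <-rec _ go
    where
    go : ∀ n → WfRec _<_ (λ k → F k ≤ F (suc k)) n → F n ≤ F (suc n)
    go n IH with tc + tm ≤? n
    ... | no  ≰  = ≤-trans (≤-reflexive (F-base n (≰⇒> ≰))) (F-positive (suc n))
    ... | yes le = begin
      F n                                        ≡⟨ F-rec n le ⟩
      F (n ∸ tc) + F (n ∸ tc ∸ tm)               ≤⟨ +-mono-≤ (IH (tc+tm≤⇒∸tc< le)) (IH (tc+tm≤⇒∸tc∸tm< le)) ⟩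
      F (suc (n ∸ tc)) + F (suc (n ∸ tc ∸ tm))   ≡⟨ cong₂ _+_ (cong F (sym 1+n∸tc)) (cong F (sym 1+n∸tc∸tm)) ⟩
      F (suc n ∸ tc) + F (suc n ∸ tc ∸ tm)       ≡⟨ sym (F-rec (suc n) (m≤n⇒m≤1+n le)) ⟩
      F (suc n)                                  ∎
      where
      open ≤-Reasoning
      1+n∸tc : suc n ∸ tc ≡ suc (n ∸ tc)
      1+n∸tc = +-∸-assoc 1 (≤-trans (m≤m+n tc tm) le)
      1+n∸tc∸tm : suc n ∸ tc ∸ tm ≡ suc (n ∸ tc ∸ tm)
      1+n∸tc∸tm = trans (cong (_∸ tm) 1+n∸tc) (+-∸-assoc 1 (m+n≤o⇒m≤o∸n tm (subst (_≤ n) (+-comm tc tm) le)))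

  F-mono : ∀ {m n} → m ≤ n → F m ≤ F n
  F-mono {m} {n} m≤n with m≤n⇒m<n∨m≡n m≤n
  ... | inj₂ refl = ≤-refl
  ... | inj₁ (s≤s m≤n-1) = ≤-trans (F-mono m≤n-1) (F-suc _)

  F-+tc : ∀ t → tm ≤ t → F (t + tc) ≡ F t + F (t ∸ tm)
  F-+tc t tm≤t = begin
    F (t + tc)                         ≡⟨ F-rec (t + tc) (subst (_≤ t + tc) (+-comm tm tc) (+-monoˡ-≤ tc tm≤t)) ⟩
    F (t + tc ∸ tc) + F (t + tc ∸ tc ∸ tm) ≡⟨ cong (λ u → F u + F (u ∸ tm)) (m+n∸n≡m t tc) ⟩
    F t + F (t ∸ tm)                   ∎
    where open ≡-Reasoning

module Actions (tc tm : ℕ) {m : ℕ} (σ : Schedule m) where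
  open Model tc tm σ

  ≡-active : ∀ {x a : Act m} → x ≡ a → a ≢ idle → x ≢ idle
  ≡-active x≡a a≢idle x≡idle = a≢idle (trans (sym x≡a) x≡idle)

  lands : ℕ → ℕ → Act m → ℕ
  lands t s (send _) = when (s + tm ≟ t) 1
  lands t s _        = 0

  compArrives-≢ : ∀ s t a → (a ≡ comp → s + tc ≢ t) → compArrives s t a ≡ 0
  compArrives-≢ s t idle     _ = refl
  compArrives-≢ s t (send _) _ = refl
  compArrives-≢ s t comp     ≢ with s + tc ≟ t
  ... | yes eq = ⊥-elim (≢ refl eq)
  ... | no  _  = refl

  compArrives-≡ : ∀ s t → s + tc ≡ t → compArrives s t comp ≡ 1
  compArrives-≡ s t eq with s + tc ≟ t
  ... | yes _ = refl
  ... | no ≢  = ⊥-elim (≢ eq)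

  sendArrives-≢ : ∀ v s t a → s + tm ≢ t → sendArrives v s t a ≡ 0
  sendArrives-≢ v s t idle     _ = refl
  sendArrives-≢ v s t comp     _ = refl
  sendArrives-≢ v s t (send w) ≢ with w ≟F v | s + tm ≟ t
  ... | yes _ | yes eq = ⊥-elim (≢ eq)
  ... | yes _ | no  _  = refl
  ... | no  _ | _      = refl

  sendArrives-elsewhere : ∀ v s t w → w ≢ v → sendArrives v s t (send w) ≡ 0
  sendArrives-elsewhere v s t w w≢v with w ≟F v
  ... | yes w≡v = ⊥-elim (w≢v w≡v)
  ... | no  _   = refl

  sendArrives-target : ∀ w s t → sendArrives w s t (send w) ≡ lands t s (send w)
  sendArrives-target w s t with w ≟F w | s + tm ≟ t
  ... | yes _ | yes _  = refl
  ... | yes _ | no  _  = refl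
  ... | no  ≢ | _      = ⊥-elim (≢ refl)

  sumFin-sendArrives : ∀ s t a → sumFin m (λ v → sendArrives v s t a) ≡ lands t s a
  sumFin-sendArrives s t idle     = sumFin-zero m (λ _ → refl)
  sumFin-sendArrives s t comp     = sumFin-zero m (λ _ → refl)
  sumFin-sendArrives s t (send w) =
    trans (sumFin-single m _ w (λ v v≢w → sendArrives-elsewhere v s t w (v≢w ∘ sym))) (sendArrives-target w s t)

module ValidSchedule (tc tm : ℕ) {m : ℕ} {σ : Schedule m} {R : ℕ} (V : Model.Valid tc tm σ R) where
  open Model tc tm σ
  open Valid V
  open Actions tc tm σ

  ends-by : ∀ v s {a} → σ v s ≡ a → a ≢ idle → s + dur a ≤ R
  ends-by v s {a} eq a≢idle = subst (λ x → s + dur x ≤ R) eq (finished v s (≡-active eq a≢idle))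

  idle-from : 0 < tc → 0 < tm → ∀ v s → R ≤ s → σ v s ≡ idle
  idle-from 0<tc 0<tm v s R≤s with σ v s in eq
  ... | idle   = refl
  ... | send _ = ⊥-elim (<⇒≱ (m<m+n s 0<tm) (≤-trans (ends-by v s eq (λ ())) R≤s))
  ... | comp   = ⊥-elim (<⇒≱ (m<m+n s 0<tc) (≤-trans (ends-by v s eq (λ ())) R≤s))

  sendArrives-after : ∀ v u s t → R < t → sendArrives v s t (σ u s) ≡ 0
  sendArrives-after v u s t R<t with σ u s in eq
  ... | idle   = refl
  ... | comp   = refl
  ... | send w = sendArrives-≢ v s t (send w) (λ s+tm≡t → <⇒≱ R<t (subst (_≤ R) s+tm≡t (ends-by u s eq (λ ()))))

  compArrives-after : ∀ v s t → R < t → compArrives s t (σ v s) ≡ 0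
  compArrives-after v s t R<t with σ v s in eq
  ... | idle   = refl
  ... | send _ = refl
  ... | comp   = compArrives-≢ s t comp (λ _ s+tc≡t → <⇒≱ R<t (subst (_≤ R) s+tc≡t (ends-by v s eq (λ ()))))

module Potential (tc tm : ℕ) (0<tc : 0 < tc) (1<tm : 1 < tm) {m : ℕ} (σ : Schedule m) where
  open Growth tc tm 0<tc
  open Model tc tm σ
  open Actions tc tm σ

  computing : ℕ → ℕ → Act m → ℕ
  computing t s comp = when (t <? s + tc) (F (s + tc))
  computing t s _    = 0

  inFlight : ℕ → ℕ → Act m → ℕ
  inFlight t s (send _) = when (t <? s + tm) (F s)
  inFlight t s _        = 0

  isSend : Act m → ℕ
  isSend (send _) = 1
  isSend _        = 0

  pending : Fin m → ℕ → ℕ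
  pending v t = sumBelow t (λ s → computing t s (σ v s))

  outgoing : Fin m → ℕ → ℕ
  outgoing v t = sumBelow t (λ s → inFlight t s (σ v s))

  delayed : ℕ → ℕ
  delayed t = F (t ∸ tm)

  idleValue : ℕ → ℕ → ℕ
  idleValue zero    t = 0
  idleValue (suc k) t = F t + k * delayed t

  -- A pending value is some F f ≥ 1, so w = 0 encodes a node that is not computing.
  nodeValue : ℕ → ℕ → ℕ → ℕ
  nodeValue k t zero      = idleValue k t
  nodeValue k t w@(suc _) = k * delayed t + w

  potential : ℕ → ℕ
  potential t = sumFin m (λ v → nodeValue (tokens v t) t (pending v t) + outgoing v t)

  nodeValue-busy : ∀ k t {w} → 0 < w → nodeValue k t w ≡ k * delayed t + w
  nodeValue-busy k t (s≤s _) = refl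

  idleValue-≤ : ∀ k t → idleValue k t ≤ k * F t
  idleValue-≤ zero    t = z≤n
  idleValue-≤ (suc k) t = +-monoʳ-≤ (F t) (*-monoʳ-≤ k (F-mono (m∸n≤m t tm)))

  ≤-idleValue : ∀ k t → k * delayed t ≤ idleValue k t
  ≤-idleValue zero    t = z≤n
  ≤-idleValue (suc k) t = +-monoˡ-≤ (k * delayed t) (F-mono (m∸n≤m t tm))

  absorb-≤ : ∀ t x k r → x + k * delayed t + r * delayed (suc t) ≤ x + (k + r) * delayed (suc t)
  absorb-≤ t x k r = begin
    x + k * d₀ + r * d₁   ≤⟨ +-monoˡ-≤ (r * d₁) (+-monoʳ-≤ x (*-monoʳ-≤ k (F-mono (∸-monoˡ-≤ tm (n≤1+n t))))) ⟩
    x + k * d₁ + r * d₁   ≡⟨ +-assoc x (k * d₁) (r * d₁) ⟩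
    x + (k * d₁ + r * d₁) ≡⟨ cong (x +_) (sym (*-distribʳ-+ d₁ k r)) ⟩
    x + (k + r) * d₁      ∎
    where
    open ≤-Reasoning
    d₀ d₁ : ℕ
    d₀ = delayed t
    d₁ = delayed (suc t)

  idleValue-+1 : ∀ k r t → idleValue (k + (r + 1)) t ≡ F t + (k + r) * delayed t
  idleValue-+1 k r t = cong (λ n → idleValue n t) (trans (cong (k +_) (+-comm r 1)) (+-suc k r))

  busy-step : ∀ t k r f → nodeValue k t (F f) + r * delayed (suc t) ≤ F f + (k + r) * delayed (suc t)
  busy-step t k r f = begin
    nodeValue k t (F f) + r * d₁ ≡⟨ cong (_+ r * d₁) (nodeValue-busy k t (F-positive f)) ⟩
    k * delayed t + F f + r * d₁ ≡⟨ cong (_+ r * d₁) (+-comm (k * delayed t) (F f)) ⟩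
    F f + k * delayed t + r * d₁ ≤⟨ absorb-≤ t (F f) k r ⟩
    F f + (k + r) * d₁           ∎
    where
    open ≤-Reasoning
    d₁ : ℕ
    d₁ = delayed (suc t)

  start-step : ∀ t j r → tm ≤ t →
               idleValue (2 + j) t + r * delayed (suc t) ≤ F (t + tc) + (j + r) * delayed (suc t)
  start-step t j r tm≤t = begin
    F t + (d₀ + j * d₀) + r * d₁ ≡⟨ cong (_+ r * d₁) (sym (+-assoc (F t) d₀ (j * d₀))) ⟩
    F t + d₀ + j * d₀ + r * d₁   ≡⟨ cong (λ x → x + j * d₀ + r * d₁) (sym (F-+tc t tm≤t)) ⟩
    F (t + tc) + j * d₀ + r * d₁ ≤⟨ absorb-≤ t (F (t + tc)) j r ⟩
    F (t + tc) + (j + r) * d₁    ∎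
    where
    open ≤-Reasoning
    d₀ d₁ : ℕ
    d₀ = delayed t
    d₁ = delayed (suc t)

  -- Situation t a w w′ c: the node starts a at round t, its pending value is w at t and w′
  -- at t + 1, and c of its computations complete at the start of round t + 1.
  data Situation (t : ℕ) : Act m → ℕ → ℕ → ℕ → Set where
    finishes        : Situation t idle (F (suc t)) 0 1
    keepsComputing  : ∀ f → Situation t idle (F f) (F f) 0
    startsFinishes  : tc ≡ 1 → Situation t comp 0 0 1
    startsComputing : Situation t comp 0 (F (t + tc)) 0
    rests           : Situation t idle 0 0 0
    sends           : ∀ w → Situation t (send w) 0 0 0

  nodeValue-step : ∀ {t a w w′ c} → Situation t a w w′ c → ∀ k r → spent a ≤ k → (a ≡ comp → tm ≤ t) →
                   nodeValue k t w + r * delayed (suc t)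
                     ≤ nodeValue ((k ∸ spent a) + (r + c)) (suc t) w′ + isSend a * F t
  nodeValue-step {t} finishes k r _ _ = begin
    nodeValue k t (F (suc t)) + r * delayed (suc t) ≤⟨ busy-step t k r (suc t) ⟩
    F (suc t) + (k + r) * delayed (suc t)           ≡⟨ sym (idleValue-+1 k r (suc t)) ⟩
    idleValue (k + (r + 1)) (suc t)                 ≡⟨ sym (+-identityʳ _) ⟩
    idleValue (k + (r + 1)) (suc t) + 0             ∎
    where open ≤-Reasoning
  nodeValue-step {t} (keepsComputing f) k r _ _ rewrite +-identityʳ r = begin
    nodeValue k t (F f) + r * delayed (suc t) ≤⟨ busy-step t k r f ⟩
    F f + (k + r) * delayed (suc t)           ≡⟨ +-comm (F f) _ ⟩
    (k + r) * delayed (suc t) + F f           ≡⟨ sym (nodeValue-busy (k + r) (suc t) (F-positive f)) ⟩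
    nodeValue (k + r) (suc t) (F f)           ≡⟨ sym (+-identityʳ _) ⟩
    nodeValue (k + r) (suc t) (F f) + 0       ∎
    where open ≤-Reasoning
  nodeValue-step {t} (startsFinishes tc≡1) (suc (suc j)) r _ tm≤t = begin
    idleValue (2 + j) t + r * delayed (suc t) ≤⟨ start-step t j r (tm≤t refl) ⟩
    F (t + tc) + (j + r) * delayed (suc t)    ≡⟨ cong (λ n → F n + (j + r) * delayed (suc t)) t+tc≡1+t ⟩
    F (suc t) + (j + r) * delayed (suc t)     ≡⟨ sym (idleValue-+1 j r (suc t)) ⟩
    idleValue (j + (r + 1)) (suc t)           ≡⟨ sym (+-identityʳ _) ⟩
    idleValue (j + (r + 1)) (suc t) + 0       ∎
    where
    open ≤-Reasoning
    t+tc≡1+t : t + tc ≡ suc t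
    t+tc≡1+t = trans (cong (t +_) tc≡1) (+-comm t 1)
  nodeValue-step {t} startsComputing (suc (suc j)) r _ tm≤t rewrite +-identityʳ r = begin
    idleValue (2 + j) t + r * delayed (suc t) ≤⟨ start-step t j r (tm≤t refl) ⟩
    F (t + tc) + (j + r) * delayed (suc t)    ≡⟨ +-comm (F (t + tc)) _ ⟩
    (j + r) * delayed (suc t) + F (t + tc)    ≡⟨ sym (nodeValue-busy (j + r) (suc t) (F-positive (t + tc))) ⟩
    nodeValue (j + r) (suc t) (F (t + tc))     ≡⟨ sym (+-identityʳ _) ⟩
    nodeValue (j + r) (suc t) (F (t + tc)) + 0 ∎
    where open ≤-Reasoning
  nodeValue-step (startsFinishes _) 1 r (s≤s ()) _
  nodeValue-step startsComputing    1 r (s≤s ()) _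
  nodeValue-step {t} rests zero r _ _ rewrite +-identityʳ r = begin
    r * delayed (suc t)     ≤⟨ ≤-idleValue r (suc t) ⟩
    idleValue r (suc t)     ≡⟨ sym (+-identityʳ _) ⟩
    idleValue r (suc t) + 0 ∎
    where open ≤-Reasoning
  nodeValue-step {t} rests (suc j) r _ _ rewrite +-identityʳ r = begin
    F t + j * delayed t + r * delayed (suc t)       ≤⟨ +-monoˡ-≤ (r * delayed (suc t)) (+-monoˡ-≤ (j * delayed t) (F-suc t)) ⟩
    F (suc t) + j * delayed t + r * delayed (suc t) ≤⟨ absorb-≤ t (F (suc t)) j r ⟩
    idleValue (suc j + r) (suc t)                   ≡⟨ sym (+-identityʳ _) ⟩
    idleValue (suc j + r) (suc t) + 0               ∎
    where open ≤-Reasoning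
  nodeValue-step {t} (sends w) (suc j) r _ _ rewrite +-identityʳ r = begin
    F t + j * delayed t + r * delayed (suc t) ≤⟨ absorb-≤ t (F t) j r ⟩
    F t + (j + r) * delayed (suc t)           ≤⟨ +-monoʳ-≤ (F t) (≤-idleValue (j + r) (suc t)) ⟩
    F t + idleValue (j + r) (suc t)           ≡⟨ +-comm (F t) _ ⟩
    idleValue (j + r) (suc t) + F t           ≡⟨ cong (idleValue (j + r) (suc t) +_) (sym (+-identityʳ (F t))) ⟩
    idleValue (j + r) (suc t) + (F t + 0)     ∎
    where open ≤-Reasoning

  computing-done : ∀ t s a → (a ≡ comp → s + tc ≤ t) → computing t s a ≡ 0
  computing-done t s idle     _    = refl
  computing-done t s (send _) _    = refl
  computing-done t s comp     done = when-no (t <? s + tc) (λ t< → <⇒≱ t< (done refl))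

  computing-running : ∀ t s → t < s + tc → computing t s comp ≡ F (s + tc)
  computing-running t s t< = when-yes (t <? s + tc) t<

  inFlight-done : ∀ t s a → (∀ w → a ≡ send w → s + tm ≤ t) → inFlight t s a ≡ 0
  inFlight-done t s idle     _    = refl
  inFlight-done t s comp     _    = refl
  inFlight-done t s (send w) done = when-no (t <? s + tm) (λ t< → <⇒≱ t< (done w refl))

  inFlight-step : ∀ t s a → inFlight t s a ≡ inFlight (suc t) s a + lands (suc t) s a * delayed (suc t)
  inFlight-step t s idle     = refl
  inFlight-step t s comp     = refl
  inFlight-step t s (send w) with t <? s + tm | suc t <? s + tm | s + tm ≟ suc t
  ... | yes _  | yes 1+t< | yes eq = ⊥-elim (<⇒≢ 1+t< (sym eq))
  ... | yes _  | yes _    | no  _  = sym (+-identityʳ (F s))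
  ... | yes _  | no  _    | yes eq = trans (cong F (sym (trans (cong (_∸ tm) (sym eq)) (m+n∸n≡m s tm))))
                                           (sym (+-identityʳ (delayed (suc t))))
  ... | yes t< | no  1+t≮ | no  ≢  = ⊥-elim (≢ (≤-antisym (≮⇒≥ 1+t≮) t<))
  ... | no  t≮ | yes 1+t< | _      = ⊥-elim (t≮ (<-trans (n<1+n t) 1+t<))
  ... | no  t≮ | no  _    | yes eq = ⊥-elim (t≮ (subst (t <_) (sym eq) (n<1+n t)))
  ... | no  _  | no  _    | no  _  = refl

  1+t<t+tm : ∀ t → suc t < t + tm
  1+t<t+tm t = subst (suc t <_) (+-comm tm t) (+-monoˡ-< t 1<tm)

  inFlight-start : ∀ t a → inFlight (suc t) t a + lands (suc t) t a * delayed (suc t) ≡ isSend a * F t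
  inFlight-start t idle     = refl
  inFlight-start t comp     = refl
  inFlight-start t (send w) = cong₂ _+_ (when-yes (suc t <? t + tm) (1+t<t+tm t))
                                        (cong (_* delayed (suc t)) (when-no (t + tm ≟ suc t) (<⇒≢ (1+t<t+tm t) ∘ sym)))

  delivered : Fin m → ℕ → ℕ
  delivered v t = sumBelow (suc t) (λ s → lands (suc t) s (σ v s))

  received : Fin m → ℕ → ℕ
  received v t = sumFin m (λ u → sumBelow (suc t) (λ s → sendArrives v s (suc t) (σ u s)))

  completed : Fin m → ℕ → ℕ
  completed v t = sumBelow (suc t) (λ s → compArrives s (suc t) (σ v s))

  outgoing-step : ∀ v t → outgoing v t + isSend (σ v t) * F t ≡ outgoing v (suc t) + delivered v t * delayed (suc t)
  outgoing-step v t = begin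
    outgoing v t + isSend (σ v t) * F t
      ≡⟨ cong₂ _+_ (sumBelow-cong t (λ s _ → inFlight-step t s (σ v s))) (sym (inFlight-start t (σ v t))) ⟩
    sumBelow (suc t) (λ s → inFlight (suc t) s (σ v s) + lands (suc t) s (σ v s) * delayed (suc t))
      ≡⟨ sumBelow-distrib-+ (suc t) _ _ ⟩
    outgoing v (suc t) + sumBelow (suc t) (λ s → lands (suc t) s (σ v s) * delayed (suc t))
      ≡⟨ cong (outgoing v (suc t) +_) (sym (sumBelow-distribʳ-* (suc t) _ (delayed (suc t)))) ⟩
    outgoing v (suc t) + delivered v t * delayed (suc t) ∎
    where
    open ≡-Reasoning

  sumFin-received : ∀ t → sumFin m (λ v → received v t) ≡ sumFin m (λ v → delivered v t)
  sumFin-received t = begin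
    sumFin m (λ v → received v t)
      ≡⟨ sumFin-comm m m _ ⟩
    sumFin m (λ u → sumFin m (λ v → sumBelow (suc t) (λ s → sendArrives v s (suc t) (σ u s))))
      ≡⟨ sumFin-cong m (λ u → sumFin-sumBelow-comm m (suc t) _) ⟩
    sumFin m (λ u → sumBelow (suc t) (λ s → sumFin m (λ v → sendArrives v s (suc t) (σ u s))))
      ≡⟨ sumFin-cong m (λ u → sumBelow-cong (suc t) (λ s _ → sumFin-sendArrives s (suc t) (σ u s))) ⟩
    sumFin m (λ v → delivered v t) ∎
    where open ≡-Reasoning

  cast : ∀ {t a a′ w w′ x x′ c c′} → a ≡ a′ → w ≡ w′ → x ≡ x′ → c ≡ c′ →
         Situation t a′ w′ x′ c′ → Situation t a w x c
  cast refl refl refl refl situation = situation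

  isComp? : (a : Act m) → Dec (a ≡ comp)
  isComp? idle     = no (λ ())
  isComp? (send _) = no (λ ())
  isComp? comp     = yes refl

  start-situation : ∀ t a → Situation t a 0 (computing (suc t) t a) (compArrives t (suc t) a)
  start-situation t idle     = rests
  start-situation t (send w) = sends w
  start-situation t comp with tc ≟ 1
  ... | yes tc≡1 = cast refl refl (computing-done (suc t) t comp (λ _ → ≤-reflexive t+tc≡1+t))
                        (compArrives-≡ t (suc t) t+tc≡1+t) (startsFinishes tc≡1)
    where
    t+tc≡1+t : t + tc ≡ suc t
    t+tc≡1+t = trans (cong (t +_) tc≡1) (+-comm t 1)
  ... | no  tc≢1 = cast refl refl (computing-running (suc t) t 1+t<t+tc)
                        (compArrives-≢ t (suc t) comp (λ _ → <⇒≢ 1+t<t+tc ∘ sym)) startsComputing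
    where
    1+t<t+tc : suc t < t + tc
    1+t<t+tc = subst (suc t <_) (+-comm tc t) (+-monoˡ-< t (≤∧≢⇒< 0<tc (tc≢1 ∘ sym)))

  module Bound {R : ℕ} (V : Valid R) where
    open Valid V
    open ValidSchedule tc tm V

    comp-ends-before : ∀ v s t → s < t → σ v s ≡ comp → σ v t ≢ idle → s + tc ≤ t
    comp-ends-before v s t s<t eq t-active = subst (λ a → s + dur a ≤ t) eq (notBusy v s t s<t (≡-active eq (λ ())) t-active)

    module Running (v : Fin m) (t s₀ : ℕ) (s₀<t : s₀ < t) (started : σ v s₀ ≡ comp) (t<end : t < s₀ + tc) where
      idle-now : σ v t ≡ idle
      idle-now with σ v t in eq
      ... | idle   = refl
      ... | send _ = ⊥-elim (<⇒≱ t<end (comp-ends-before v s₀ t s₀<t started (≡-active eq (λ ()))))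
      ... | comp   = ⊥-elim (<⇒≱ t<end (comp-ends-before v s₀ t s₀<t started (≡-active eq (λ ()))))

      others-done : ∀ s → s ≤ t → s ≢ s₀ → σ v s ≡ comp → s + tc ≤ t
      others-done s s≤t s≢s₀ eq with m≤n⇒m<n∨m≡n s≤t
      ... | inj₂ refl = ⊥-elim (≡-active eq (λ ()) idle-now)
      ... | inj₁ s<t with <-cmp s s₀
      ...   | tri< s<s₀ _ _ = ≤-trans (comp-ends-before v s s₀ s<s₀ eq (≡-active started (λ ()))) (<⇒≤ s₀<t)
      ...   | tri≈ _ s≡s₀ _ = ⊥-elim (s≢s₀ s≡s₀)
      ...   | tri> _ _ s₀<s = ⊥-elim (<⇒≱ t<end (≤-trans (comp-ends-before v s₀ s s₀<s started (≡-active eq (λ ()))) (<⇒≤ s<t)))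

      pending-now : pending v t ≡ F (s₀ + tc)
      pending-now = trans (sumBelow-single t s₀ s₀<t (λ s s<t s≢s₀ → computing-done t s (σ v s) (others-done s (<⇒≤ s<t) s≢s₀)))
                          (trans (cong (computing t s₀) started) (computing-running t s₀ t<end))

      pending-next : pending v (suc t) ≡ computing (suc t) s₀ comp
      pending-next = trans (sumBelow-single (suc t) s₀ (m<n⇒m<1+n s₀<t)
                             (λ s s<1+t s≢s₀ → computing-done (suc t) s (σ v s) (m≤n⇒m≤1+n ∘ others-done s (≤-pred s<1+t) s≢s₀)))
                           (cong (computing (suc t) s₀) started)

      completed-now : completed v t ≡ compArrives s₀ (suc t) comp
      completed-now = trans (sumBelow-single (suc t) s₀ (m<n⇒m<1+n s₀<t)
                              (λ s s<1+t s≢s₀ → compArrives-≢ s (suc t) (σ v s)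
                                 (λ eq → <⇒≢ (s≤s (others-done s (≤-pred s<1+t) s≢s₀ eq)))))
                            (cong (compArrives s₀ (suc t)) started)

      situation : Situation t (σ v t) (pending v t) (pending v (suc t)) (completed v t)
      situation with s₀ + tc ≟ suc t
      ... | yes ends = cast idle-now (trans pending-now (cong F ends))
                            (trans pending-next (computing-done (suc t) s₀ comp (λ _ → ≤-reflexive ends)))
                            (trans completed-now (compArrives-≡ s₀ (suc t) ends)) finishes
      ... | no  ≢    = cast idle-now pending-now
                            (trans pending-next (computing-running (suc t) s₀ (≤∧≢⇒< t<end (≢ ∘ sym))))
                            (trans completed-now (compArrives-≢ s₀ (suc t) comp (λ _ → ≢))) (keepsComputing (s₀ + tc))

    module Free (v : Fin m) (t : ℕ) (all-done : ∀ s → s < t → σ v s ≡ comp → s + tc ≤ t) where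
      earlier : ∀ {s} → s < suc t → s ≢ t → s < t
      earlier s<1+t s≢t = ≤∧≢⇒< (≤-pred s<1+t) s≢t

      situation : Situation t (σ v t) (pending v t) (pending v (suc t)) (completed v t)
      situation = cast refl
        (sumBelow-zero t (λ s s<t → computing-done t s (σ v s) (all-done s s<t)))
        (sumBelow-single (suc t) t ≤-refl (λ s s<1+t s≢t →
           computing-done (suc t) s (σ v s) (m≤n⇒m≤1+n ∘ all-done s (earlier s<1+t s≢t))))
        (sumBelow-single (suc t) t ≤-refl (λ s s<1+t s≢t →
           compArrives-≢ s (suc t) (σ v s) (λ eq → <⇒≢ (s≤s (all-done s (earlier s<1+t s≢t) eq)))))
        (start-situation t (σ v t))

    situation : ∀ v t → Situation t (σ v t) (pending v t) (pending v (suc t)) (completed v t)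
    situation v t with anyUpTo? (λ s → isComp? (σ v s) ×-dec (t <? s + tc)) t
    ... | yes (s₀ , s₀<t , started , t<end) = Running.situation v t s₀ s₀<t started t<end
    ... | no  ∄ = Free.situation v t (λ s s<t started → ≮⇒≥ (λ t<end → ∄ (s , s<t , started , t<end)))

    -- Nothing can arrive before round tm, so no node can compute before then.
    at-most-one-token : ∀ v t → t < tm → ∀ {s} → s ≤ t → tokens v s ≤ 1
    at-most-one-token v zero    _      z≤n = ≤-refl
    at-most-one-token v (suc t) 1+t<tm s≤1+t with m≤n⇒m<n∨m≡n s≤1+t
    ... | inj₁ (s≤s s≤t) = at-most-one-token v t (<-trans (n<1+n t) 1+t<tm) s≤t
    ... | inj₂ refl = begin
      tokens v t ∸ spent (σ v t) + (received v t + completed v t)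
        ≡⟨ cong (tokens v t ∸ spent (σ v t) +_) (cong₂ _+_ none-received none-completed) ⟩
      tokens v t ∸ spent (σ v t) + 0 ≡⟨ +-identityʳ _ ⟩
      tokens v t ∸ spent (σ v t)     ≤⟨ m∸n≤m (tokens v t) (spent (σ v t)) ⟩
      tokens v t                     ≤⟨ earlier ≤-refl ⟩
      1                              ∎
      where
      open ≤-Reasoning
      earlier : ∀ {s} → s ≤ t → tokens v s ≤ 1
      earlier = at-most-one-token v t (<-trans (n<1+n t) 1+t<tm)
      none-received : received v t ≡ 0
      none-received = sumFin-zero m (λ u → sumBelow-zero (suc t) (λ s _ → sendArrives-≢ v s (suc t) (σ u s)
                        (λ s+tm≡1+t → <⇒≱ 1+t<tm (subst (tm ≤_) s+tm≡1+t (m≤n+m tm s)))))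
      none-completed : completed v t ≡ 0
      none-completed = sumBelow-zero (suc t) (λ s s<1+t → compArrives-≢ s (suc t) (σ v s) (λ eq _ →
                         <⇒≱ (s≤s ≤-refl) (≤-trans (subst (λ a → spent a ≤ tokens v s) eq (enough v s)) (earlier (≤-pred s<1+t)))))

    comp⇒tm≤ : ∀ v t → σ v t ≡ comp → tm ≤ t
    comp⇒tm≤ v t eq = ≮⇒≥ (λ t<tm → <⇒≱ (s≤s ≤-refl)
                        (≤-trans (subst (λ a → spent a ≤ tokens v t) eq (enough v t)) (at-most-one-token v t t<tm ≤-refl)))

    potential-step : ∀ t → potential t ≤ potential (suc t)
    potential-step t = begin
      potential t                     ≡⟨ sumFin-distrib-+ m n₀ o₀ ⟩
      sumFin m n₀ + sumFin m o₀       ≤⟨ transfer-≤ {sumFin m n₀} {sumFin m n₁} {sumFin m o₀} {sumFin m o₁} nodes flow ⟩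
      sumFin m n₁ + sumFin m o₁       ≡⟨ sym (sumFin-distrib-+ m n₁ o₁) ⟩
      potential (suc t)               ∎
      where
      open ≤-Reasoning
      d₁ : ℕ
      d₁ = delayed (suc t)
      n₀ n₁ o₀ o₁ sent gained : Fin m → ℕ
      n₀ v = nodeValue (tokens v t) t (pending v t)
      n₁ v = nodeValue (tokens v (suc t)) (suc t) (pending v (suc t))
      o₀ v = outgoing v t
      o₁ v = outgoing v (suc t)
      sent v = isSend (σ v t) * F t
      gained v = received v t * d₁
      nodes : sumFin m n₀ + sumFin m gained ≤ sumFin m n₁ + sumFin m sent
      nodes = begin
        sumFin m n₀ + sumFin m gained      ≡⟨ sym (sumFin-distrib-+ m n₀ gained) ⟩
        sumFin m (λ v → n₀ v + gained v)   ≤⟨ sumFin-mono-≤ m (λ v → nodeValue-step (situation v t) (tokens v t) (received v t)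
                                                                   (enough v t) (comp⇒tm≤ v t)) ⟩
        sumFin m (λ v → n₁ v + sent v)     ≡⟨ sumFin-distrib-+ m n₁ sent ⟩
        sumFin m n₁ + sumFin m sent        ∎
      flow : sumFin m o₀ + sumFin m sent ≡ sumFin m o₁ + sumFin m gained
      flow = begin-equality
        sumFin m o₀ + sumFin m sent                             ≡⟨ sym (sumFin-distrib-+ m o₀ sent) ⟩
        sumFin m (λ v → o₀ v + sent v)                          ≡⟨ sumFin-cong m (λ v → outgoing-step v t) ⟩
        sumFin m (λ v → o₁ v + delivered v t * d₁)              ≡⟨ sumFin-distrib-+ m o₁ _ ⟩
        sumFin m o₁ + sumFin m (λ v → delivered v t * d₁)       ≡⟨ cong (sumFin m o₁ +_) (sym (sumFin-distribʳ-* m _ d₁)) ⟩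
        sumFin m o₁ + sumFin m (λ v → delivered v t) * d₁       ≡⟨ cong (λ x → sumFin m o₁ + x * d₁) (sym (sumFin-received t)) ⟩
        sumFin m o₁ + sumFin m (λ v → received v t) * d₁        ≡⟨ cong (sumFin m o₁ +_) (sumFin-distribʳ-* m _ d₁) ⟩
        sumFin m o₁ + sumFin m gained                           ∎

    potential-mono : ∀ t → potential 0 ≤ potential t
    potential-mono zero    = ≤-refl
    potential-mono (suc t) = ≤-trans (potential-mono t) (potential-step t)

    potential-initial : potential 0 ≡ m
    potential-initial = trans (sumFin-cong m (λ _ → trans (+-identityʳ _) (trans (+-identityʳ (F 0)) F0≡1))) (sumFin-one m)
      where
      F0≡1 : F 0 ≡ 1
      F0≡1 = F-base 0 (≤-trans 0<tc (m≤m+n tc tm))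

    potential-final : potential R ≤ F R
    potential-final = begin
      potential R                                     ≡⟨ sumFin-cong m (λ v → cong₂ (λ w o → nodeValue (tokens v R) R w + o) (nothing-pending v) (nothing-in-flight v)) ⟩
      sumFin m (λ v → idleValue (tokens v R) R + 0)   ≤⟨ sumFin-mono-≤ m (λ v → ≤-trans (≤-reflexive (+-identityʳ _)) (idleValue-≤ (tokens v R) R)) ⟩
      sumFin m (λ v → tokens v R * F R)               ≡⟨ sym (sumFin-distribʳ-* m _ (F R)) ⟩
      sumFin m (λ v → tokens v R) * F R               ≡⟨ cong (_* F R) oneLeft ⟩
      1 * F R                                         ≡⟨ *-identityˡ (F R) ⟩
      F R                                             ∎
      where
      open ≤-Reasoning
      nothing-pending : ∀ v → pending v R ≡ 0
      nothing-pending v = sumBelow-zero R (λ s _ → computing-done R s (σ v s) (λ eq → ends-by v s eq (λ ())))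
      nothing-in-flight : ∀ v → outgoing v R ≡ 0
      nothing-in-flight v = sumBelow-zero R (λ s _ → inFlight-done R s (σ v s) (λ w eq → ends-by v s eq (λ ())))

upper-bound : ∀ tc tm (0<tc : 0 < tc) → 1 < tm → ∀ m R → Solvable tc tm m R → m ≤ Growth.F tc tm 0<tc R
upper-bound tc tm 0<tc 1<tm m R (σ , V) = begin
  m             ≡⟨ sym potential-initial ⟩
  potential 0   ≤⟨ potential-mono R ⟩
  potential R   ≤⟨ potential-final ⟩
  F R           ∎
  where
  open ≤-Reasoning
  open Growth tc tm 0<tc
  open Potential tc tm 0<tc 1<tm σ
  open Bound V

relabel : ∀ {a n} → (Fin a → Fin n) → Act a → Act n
relabel ι idle     = idle
relabel ι comp     = comp
relabel ι (send w) = send (ι w)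

relabel-active : ∀ {a n} (ι : Fin a → Fin n) {x} → relabel ι x ≢ idle → x ≢ idle
relabel-active ι active x≡idle = active (cong (relabel ι) x≡idle)

relabel-send : ∀ {a n} (ι : Fin a → Fin n) x {w} → relabel ι x ≡ send w → Σ (Fin a) λ w₀ → x ≡ send w₀ × ι w₀ ≡ w
relabel-send ι (send w₀) refl = w₀ , refl , refl

-- The schedules only instantiate Model: spent, dur and the arrival counts do not depend on them.
module Relabel (tc tm : ℕ) {a n : ℕ} (ι : Fin a → Fin n) (ι-injective : ∀ {i j} → ι i ≡ ι j → i ≡ j)
               (σₐ : Schedule a) (σₙ : Schedule n) where
  private
    module A = Model tc tm σₐ
  open Model tc tm σₙ

  spent-relabel : ∀ x → spent (relabel ι x) ≡ A.spent x
  spent-relabel idle     = refl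
  spent-relabel comp     = refl
  spent-relabel (send _) = refl

  dur-relabel : ∀ x → dur (relabel ι x) ≡ A.dur x
  dur-relabel idle     = refl
  dur-relabel comp     = refl
  dur-relabel (send _) = refl

  compArrives-relabel : ∀ s t x → compArrives s t (relabel ι x) ≡ A.compArrives s t x
  compArrives-relabel s t idle     = refl
  compArrives-relabel s t (send _) = refl
  compArrives-relabel s t comp with s + tc ≟ t
  ... | yes _ = refl
  ... | no  _ = refl

  sendArrives-relabel : ∀ i s t x → sendArrives (ι i) s t (relabel ι x) ≡ A.sendArrives i s t x
  sendArrives-relabel i s t idle     = refl
  sendArrives-relabel i s t comp     = refl
  sendArrives-relabel i s t (send w) with w ≟F i | ι w ≟F ι i | s + tm ≟ t
  ... | yes _   | yes _    | yes _ = refl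
  ... | yes _   | yes _    | no  _ = refl
  ... | yes w≡i | no  ιw≢ιi | _    = ⊥-elim (ιw≢ιi (cong ι w≡i))
  ... | no  w≢i | yes ιw≡ιi | _    = ⊥-elim (w≢i (ι-injective ιw≡ιi))
  ... | no  _   | no  _    | _     = refl

  sendArrives-relabel-outside : ∀ v s t x → (∀ i → ι i ≢ v) → sendArrives v s t (relabel ι x) ≡ 0
  sendArrives-relabel-outside v s t idle     _       = refl
  sendArrives-relabel-outside v s t comp     _       = refl
  sendArrives-relabel-outside v s t (send w) outside with ι w ≟F v
  ... | yes ιw≡v = ⊥-elim (outside w ιw≡v)
  ... | no  _    = refl

idle-schedule : ∀ {m} → Schedule m
idle-schedule _ _ = idle

single-node : ∀ tc tm R → Solvable tc tm 1 R
single-node tc tm R = idle-schedule , record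
  { neighbour = λ _ _ _ ()
  ; enough    = λ _ _ → z≤n
  ; notBusy   = λ _ _ _ _ active _ → ⊥-elim (active refl)
  ; finished  = λ _ _ active → ⊥-elim (active refl)
  ; oneLeft   = trans (+-identityʳ _) (always-one R)
  }
  where
  open Model tc tm (idle-schedule {1})
  always-one : ∀ t → tokens fzero t ≡ 1
  always-one zero    = refl
  always-one (suc t) = cong₂ _+_ (always-one t)
    (cong₂ _+_ (trans (+-identityʳ _) (sumBelow-zero (suc t) (λ _ _ → refl))) (sumBelow-zero (suc t) (λ _ _ → refl)))

data Side (a b : ℕ) : Fin (a + b) → Set where
  onLeft  : ∀ i → Side a b (i ↑ˡ b)
  onRight : ∀ j → Side a b (a ↑ʳ j)

side : ∀ a b v → Side a b v
side a b v with splitAt a v in eq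
... | inj₁ i = subst (Side a b) (splitAt⁻¹-↑ˡ eq) (onLeft i)
... | inj₂ j = subst (Side a b) (splitAt⁻¹-↑ʳ eq) (onRight j)

↑ˡ≢↑ʳ : ∀ {a b} (i : Fin a) (j : Fin b) → i ↑ˡ b ≢ a ↑ʳ j
↑ˡ≢↑ʳ {a} {b} i j eq with () ← trans (sym (splitAt-↑ˡ a i b)) (trans (cong (splitAt a) eq) (splitAt-↑ʳ a b j))

module Glue (tc tm : ℕ) (0<tc : 0 < tc) (0<tm : 0 < tm) {a b : ℕ}
            (σ₁ : Schedule a) (σ₂ : Schedule b) (R₂ : ℕ)
            (V₁ : Model.Valid tc tm σ₁ (R₂ + tm)) (V₂ : Model.Valid tc tm σ₂ R₂) where
  R₁ R : ℕ
  R₁ = R₂ + tm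
  R  = R₁ + tc

  private
    module M₁ = Model tc tm σ₁
    module M₂ = Model tc tm σ₂
    module V₁ = M₁.Valid V₁
    module V₂ = M₂.Valid V₂
    module S₁ = ValidSchedule tc tm V₁
    module S₂ = ValidSchedule tc tm V₂

    last₁ : Σ (Fin a) λ h → M₁.tokens h R₁ ≡ 1 × (∀ i → i ≢ h → M₁.tokens i R₁ ≡ 0)
    last₁ = sumFin≡1⇒single a (λ i → M₁.tokens i R₁) V₁.oneLeft
    last₂ : Σ (Fin b) λ h → M₂.tokens h R₂ ≡ 1 × (∀ j → j ≢ h → M₂.tokens j R₂ ≡ 0)
    last₂ = sumFin≡1⇒single b (λ j → M₂.tokens j R₂) V₂.oneLeft

  h₁ : Fin a
  h₁ = proj₁ last₁

  h₂ : Fin b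
  h₂ = proj₁ last₂

  ↑L : Act a → Act (a + b)
  ↑L = relabel (_↑ˡ b)

  ↑R : Act b → Act (a + b)
  ↑R = relabel (a ↑ʳ_)

  left : Fin a → ℕ → Act (a + b)
  left i s with s ≟ R₁ | i ≟F h₁
  ... | yes _ | yes _ = comp
  ... | _     | _     = ↑L (σ₁ i s)

  right : Fin b → ℕ → Act (a + b)
  right j s with s ≟ R₂ | j ≟F h₂
  ... | yes _ | yes _ = send (h₁ ↑ˡ b)
  ... | _     | _     = ↑R (σ₂ j s)

  σ : Schedule (a + b)
  σ v s = [ (λ i → left i s) , (λ j → right j s) ]′ (splitAt a v)

  open Model tc tm σ
  open Actions tc tm σ
  private
    module L = Relabel tc tm (_↑ˡ b) (↑ˡ-injective b _ _) σ₁ σ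
    module Rt = Relabel tc tm (a ↑ʳ_) (↑ʳ-injective a _ _) σ₂ σ

  σ-left : ∀ i s → σ (i ↑ˡ b) s ≡ left i s
  σ-left i s = cong [ (λ i → left i s) , (λ j → right j s) ]′ (splitAt-↑ˡ a i b)

  σ-right : ∀ j s → σ (a ↑ʳ j) s ≡ right j s
  σ-right j s = cong [ (λ i → left i s) , (λ j → right j s) ]′ (splitAt-↑ʳ a b j)

  left-shape : ∀ i s → (s ≡ R₁ × i ≡ h₁ × left i s ≡ comp) ⊎ ((s ≡ R₁ → i ≢ h₁) × left i s ≡ ↑L (σ₁ i s))
  left-shape i s with s ≟ R₁ | i ≟F h₁
  ... | yes s≡R₁ | yes i≡h₁ = inj₁ (s≡R₁ , i≡h₁ , refl)
  ... | yes _    | no  i≢h₁ = inj₂ ((λ _ → i≢h₁) , refl)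
  ... | no  s≢R₁ | _        = inj₂ ((λ s≡R₁ → ⊥-elim (s≢R₁ s≡R₁)) , refl)

  right-shape : ∀ j s → (s ≡ R₂ × j ≡ h₂ × right j s ≡ send (h₁ ↑ˡ b)) ⊎ ((s ≡ R₂ → j ≢ h₂) × right j s ≡ ↑R (σ₂ j s))
  right-shape j s with s ≟ R₂ | j ≟F h₂
  ... | yes s≡R₂ | yes j≡h₂ = inj₁ (s≡R₂ , j≡h₂ , refl)
  ... | yes _    | no  j≢h₂ = inj₂ ((λ _ → j≢h₂) , refl)
  ... | no  s≢R₂ | _        = inj₂ ((λ s≡R₂ → ⊥-elim (s≢R₂ s≡R₂)) , refl)

  left-ordinary : ∀ i s → (s ≡ R₁ → i ≢ h₁) → left i s ≡ ↑L (σ₁ i s)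
  left-ordinary i s not-final with left-shape i s
  ... | inj₁ (s≡R₁ , i≡h₁ , _) = ⊥-elim (not-final s≡R₁ i≡h₁)
  ... | inj₂ (_ , eq)          = eq

  right-ordinary : ∀ j s → (s ≡ R₂ → j ≢ h₂) → right j s ≡ ↑R (σ₂ j s)
  right-ordinary j s not-final with right-shape j s
  ... | inj₁ (s≡R₂ , j≡h₂ , _) = ⊥-elim (not-final s≡R₂ j≡h₂)
  ... | inj₂ (_ , eq)          = eq

  left-final : left h₁ R₁ ≡ comp
  left-final with left-shape h₁ R₁
  ... | inj₁ (_ , _ , eq)  = eq
  ... | inj₂ (not-final , _) = ⊥-elim (not-final refl refl)

  right-final : right h₂ R₂ ≡ send (h₁ ↑ˡ b)
  right-final with right-shape h₂ R₂
  ... | inj₁ (_ , _ , eq)  = eq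
  ... | inj₂ (not-final , _) = ⊥-elim (not-final refl refl)

  left-idle : ∀ i s → R₁ ≤ s → (s ≡ R₁ → i ≢ h₁) → left i s ≡ idle
  left-idle i s R₁≤s not-final = trans (left-ordinary i s not-final) (cong ↑L (S₁.idle-from 0<tc 0<tm i s R₁≤s))

  right-idle : ∀ j s → R₂ ≤ s → (s ≡ R₂ → j ≢ h₂) → right j s ≡ idle
  right-idle j s R₂≤s not-final = trans (right-ordinary j s not-final) (cong ↑R (S₂.idle-from 0<tc 0<tm j s R₂≤s))

  arrivals-split : ∀ v t → arrivals v t ≡
    sumFin a (λ i → sumBelow t (λ s → sendArrives v s t (left i s))) +
    sumFin b (λ j → sumBelow t (λ s → sendArrives v s t (right j s))) +
    sumBelow t (λ s → compArrives s t (σ v s))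
  arrivals-split v t = cong (_+ sumBelow t (λ s → compArrives s t (σ v s))) (trans (sumFin-++ a b _)
    (cong₂ _+_ (sumFin-cong a (λ i → sumBelow-cong t (λ s _ → cong (sendArrives v s t) (σ-left i s))))
               (sumFin-cong b (λ j → sumBelow-cong t (λ s _ → cong (sendArrives v s t) (σ-right j s))))))

  left-to-right : ∀ j i s t → sendArrives (a ↑ʳ j) s t (left i s) ≡ 0
  left-to-right j i s t with left-shape i s
  ... | inj₁ (_ , _ , eq) = cong (sendArrives (a ↑ʳ j) s t) eq
  ... | inj₂ (_ , eq)     = trans (cong (sendArrives (a ↑ʳ j) s t) eq)
                                  (L.sendArrives-relabel-outside (a ↑ʳ j) s t (σ₁ i s) (λ i′ → ↑ˡ≢↑ʳ i′ j))

  right-to-left : ∀ i j s t → (s ≡ R₂ → j ≢ h₂) → sendArrives (i ↑ˡ b) s t (right j s) ≡ 0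
  right-to-left i j s t not-final = trans (cong (sendArrives (i ↑ˡ b) s t) (right-ordinary j s not-final))
    (Rt.sendArrives-relabel-outside (i ↑ˡ b) s t (σ₂ j s) (λ j′ eq → ↑ˡ≢↑ʳ i j′ (sym eq)))

  right-before : ∀ j s → s < R₂ → σ (a ↑ʳ j) s ≡ ↑R (σ₂ j s)
  right-before j s s<R₂ = trans (σ-right j s) (right-ordinary j s (⊥-elim ∘ <⇒≢ s<R₂))

  arrivals-right : ∀ j t → t ≤ R₂ → arrivals (a ↑ʳ j) t ≡ M₂.arrivals j t
  arrivals-right j t t≤R₂ = trans (arrivals-split (a ↑ʳ j) t) (cong₂ _+_ (cong₂ _+_ from-left from-right) computed)
    where
    s<R₂ : ∀ {s} → s < t → s < R₂
    s<R₂ s<t = <-≤-trans s<t t≤R₂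
    from-left : sumFin a (λ i → sumBelow t (λ s → sendArrives (a ↑ʳ j) s t (left i s))) ≡ 0
    from-left = sumFin-zero a (λ i → sumBelow-zero t (λ s _ → left-to-right j i s t))
    from-right : sumFin b (λ u → sumBelow t (λ s → sendArrives (a ↑ʳ j) s t (right u s))) ≡
                 sumFin b (λ u → sumBelow t (λ s → M₂.sendArrives j s t (σ₂ u s)))
    from-right = sumFin-cong b (λ u → sumBelow-cong t (λ s s<t →
      trans (cong (sendArrives (a ↑ʳ j) s t) (trans (sym (σ-right u s)) (right-before u s (s<R₂ s<t))))
            (Rt.sendArrives-relabel j s t (σ₂ u s))))
    computed : sumBelow t (λ s → compArrives s t (σ (a ↑ʳ j) s)) ≡ sumBelow t (λ s → M₂.compArrives s t (σ₂ j s))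
    computed = sumBelow-cong t (λ s s<t →
      trans (cong (compArrives s t) (right-before j s (s<R₂ s<t))) (Rt.compArrives-relabel s t (σ₂ j s)))

  tokens-right : ∀ j t → t ≤ R₂ → tokens (a ↑ʳ j) t ≡ M₂.tokens j t
  tokens-right j zero    _      = refl
  tokens-right j (suc t) 1+t≤R₂ = cong₂ _+_
    (cong₂ _∸_ (tokens-right j t (<⇒≤ 1+t≤R₂))
               (trans (cong spent (right-before j t 1+t≤R₂)) (Rt.spent-relabel (σ₂ j t))))
    (arrivals-right j (suc t) 1+t≤R₂)

  right-sent : ∀ j → tokens (a ↑ʳ j) R₂ ∸ spent (σ (a ↑ʳ j) R₂) ≡ 0
  right-sent j with j ≟F h₂
  ... | yes refl = cong₂ _∸_ (trans (tokens-right h₂ R₂ ≤-refl) (proj₁ (proj₂ last₂)))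
                             (cong spent (trans (σ-right h₂ R₂) right-final))
  ... | no  j≢h₂ = trans (cong (_∸ spent (σ (a ↑ʳ j) R₂)) (trans (tokens-right j R₂ ≤-refl) (proj₂ (proj₂ last₂) j j≢h₂)))
                         (0∸n≡0 (spent (σ (a ↑ʳ j) R₂)))

  arrivals-right-after : ∀ j t → R₂ < t → arrivals (a ↑ʳ j) t ≡ 0
  arrivals-right-after j t R₂<t = trans (arrivals-split (a ↑ʳ j) t) (cong₂ _+_ (cong₂ _+_ from-left from-right) computed)
    where
    from-left : sumFin a (λ i → sumBelow t (λ s → sendArrives (a ↑ʳ j) s t (left i s))) ≡ 0
    from-left = sumFin-zero a (λ i → sumBelow-zero t (λ s _ → left-to-right j i s t))
    to-right : ∀ u s → sendArrives (a ↑ʳ j) s t (right u s) ≡ 0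
    to-right u s with right-shape u s
    ... | inj₁ (_ , _ , eq) = trans (cong (sendArrives (a ↑ʳ j) s t) eq) (sendArrives-elsewhere (a ↑ʳ j) s t (h₁ ↑ˡ b) (↑ˡ≢↑ʳ h₁ j))
    ... | inj₂ (_ , eq)     = trans (cong (sendArrives (a ↑ʳ j) s t) eq)
                                    (trans (Rt.sendArrives-relabel j s t (σ₂ u s)) (S₂.sendArrives-after j u s t R₂<t))
    from-right : sumFin b (λ u → sumBelow t (λ s → sendArrives (a ↑ʳ j) s t (right u s))) ≡ 0
    from-right = sumFin-zero b (λ u → sumBelow-zero t (λ s _ → to-right u s))
    computes : ∀ s → compArrives s t (σ (a ↑ʳ j) s) ≡ 0
    computes s with right-shape j s
    ... | inj₁ (_ , _ , eq) = cong (compArrives s t) (trans (σ-right j s) eq)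
    ... | inj₂ (_ , eq)     = trans (cong (compArrives s t) (trans (σ-right j s) eq))
                                    (trans (Rt.compArrives-relabel s t (σ₂ j s)) (S₂.compArrives-after j s t R₂<t))
    computed : sumBelow t (λ s → compArrives s t (σ (a ↑ʳ j) s)) ≡ 0
    computed = sumBelow-zero t (λ s _ → computes s)

  tokens-right-after : ∀ j t → R₂ < t → tokens (a ↑ʳ j) t ≡ 0
  tokens-right-after j (suc t) R₂<1+t = trans (cong (_+ arrivals (a ↑ʳ j) (suc t)) nothing-kept) (arrivals-right-after j (suc t) R₂<1+t)
    where
    nothing-kept : tokens (a ↑ʳ j) t ∸ spent (σ (a ↑ʳ j) t) ≡ 0
    nothing-kept with m≤n⇒m<n∨m≡n (≤-pred R₂<1+t)
    ... | inj₂ refl = right-sent j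
    ... | inj₁ R₂<t = trans (cong (_∸ spent (σ (a ↑ʳ j) t)) (tokens-right-after j t R₂<t)) (0∸n≡0 (spent (σ (a ↑ʳ j) t)))

  left-before : ∀ i s → s < R₁ → σ (i ↑ˡ b) s ≡ ↑L (σ₁ i s)
  left-before i s s<R₁ = trans (σ-left i s) (left-ordinary i s (⊥-elim ∘ <⇒≢ s<R₁))

  incoming : Fin a → ℕ → ℕ
  incoming i t = sumFin b (λ j → sumBelow t (λ s → sendArrives (i ↑ˡ b) s t (right j s)))

  incoming-≢ : ∀ i t → t ≢ R₁ → incoming i t ≡ 0
  incoming-≢ i t t≢R₁ = sumFin-zero b (λ j → sumBelow-zero t (λ s _ → from j s))
    where
    from : ∀ j s → sendArrives (i ↑ˡ b) s t (right j s) ≡ 0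
    from j s with right-shape j s
    ... | inj₁ (refl , _ , eq) = trans (cong (sendArrives (i ↑ˡ b) R₂ t) eq) (sendArrives-≢ (i ↑ˡ b) R₂ t _ (t≢R₁ ∘ sym))
    ... | inj₂ (not-final , _) = right-to-left i j s t not-final

  incoming-R₁ : ∀ i → incoming i R₁ ≡ sendArrives (i ↑ˡ b) R₂ R₁ (send (h₁ ↑ˡ b))
  incoming-R₁ i = begin
    incoming i R₁                                             ≡⟨ sumFin-single b _ h₂ (λ j j≢h₂ →
                                                                   sumBelow-zero R₁ (λ s _ → right-to-left i j s R₁ (λ _ → j≢h₂))) ⟩
    sumBelow R₁ (λ s → sendArrives (i ↑ˡ b) s R₁ (right h₂ s)) ≡⟨ sumBelow-single R₁ R₂ (m<m+n R₂ 0<tm) (λ s _ s≢R₂ →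
                                                                   right-to-left i h₂ s R₁ (⊥-elim ∘ s≢R₂)) ⟩
    sendArrives (i ↑ˡ b) R₂ R₁ (right h₂ R₂)                  ≡⟨ cong (sendArrives (i ↑ˡ b) R₂ R₁) right-final ⟩
    sendArrives (i ↑ˡ b) R₂ R₁ (send (h₁ ↑ˡ b))               ∎
    where open ≡-Reasoning

  arrivals-left : ∀ i t → t ≤ R₁ → arrivals (i ↑ˡ b) t ≡ M₁.arrivals i t + incoming i t
  arrivals-left i t t≤R₁ = trans (arrivals-split (i ↑ˡ b) t)
    (trans (cong₂ _+_ (cong (_+ incoming i t) from-left) computed)
           (xy∙z≈xz∙y (sumFin a (λ u → sumBelow t (λ s → M₁.sendArrives i s t (σ₁ u s)))) (incoming i t) _))
    where
    s<R₁ : ∀ {s} → s < t → s < R₁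
    s<R₁ s<t = <-≤-trans s<t t≤R₁
    from-left : sumFin a (λ u → sumBelow t (λ s → sendArrives (i ↑ˡ b) s t (left u s))) ≡
                sumFin a (λ u → sumBelow t (λ s → M₁.sendArrives i s t (σ₁ u s)))
    from-left = sumFin-cong a (λ u → sumBelow-cong t (λ s s<t →
      trans (cong (sendArrives (i ↑ˡ b) s t) (trans (sym (σ-left u s)) (left-before u s (s<R₁ s<t))))
            (L.sendArrives-relabel i s t (σ₁ u s))))
    computed : sumBelow t (λ s → compArrives s t (σ (i ↑ˡ b) s)) ≡ sumBelow t (λ s → M₁.compArrives s t (σ₁ i s))
    computed = sumBelow-cong t (λ s s<t →
      trans (cong (compArrives s t) (left-before i s (s<R₁ s<t))) (L.compArrives-relabel s t (σ₁ i s)))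

  tokens-left : ∀ i t → t ≤ R₁ → tokens (i ↑ˡ b) t ≡ M₁.tokens i t + incoming i t
  tokens-left i zero    _      = cong suc (sym (incoming-≢ i 0 (<⇒≢ (≤-trans 0<tm (m≤n+m tm R₂)))))
  tokens-left i (suc t) 1+t≤R₁ = begin
    tokens (i ↑ˡ b) t ∸ spent (σ (i ↑ˡ b) t) + arrivals (i ↑ˡ b) (suc t)
      ≡⟨ cong₂ _+_ (cong₂ _∸_ kept spent-same) (arrivals-left i (suc t) 1+t≤R₁) ⟩
    M₁.tokens i t ∸ M₁.spent (σ₁ i t) + (M₁.arrivals i (suc t) + incoming i (suc t))
      ≡⟨ sym (+-assoc (M₁.tokens i t ∸ M₁.spent (σ₁ i t)) (M₁.arrivals i (suc t)) (incoming i (suc t))) ⟩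
    M₁.tokens i (suc t) + incoming i (suc t) ∎
    where
    open ≡-Reasoning
    kept : tokens (i ↑ˡ b) t ≡ M₁.tokens i t
    kept = trans (tokens-left i t (<⇒≤ 1+t≤R₁))
                 (trans (cong (M₁.tokens i t +_) (incoming-≢ i t (<⇒≢ 1+t≤R₁))) (+-identityʳ _))
    spent-same : spent (σ (i ↑ˡ b) t) ≡ M₁.spent (σ₁ i t)
    spent-same = trans (cong spent (left-before i t 1+t≤R₁)) (L.spent-relabel (σ₁ i t))

  left-at-R₁ : ∀ i → tokens (i ↑ˡ b) R₁ ≡ spent (σ (i ↑ˡ b) R₁)
  left-at-R₁ i with i ≟F h₁
  ... | yes refl = begin
    tokens (h₁ ↑ˡ b) R₁                                            ≡⟨ tokens-left h₁ R₁ ≤-refl ⟩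
    M₁.tokens h₁ R₁ + incoming h₁ R₁                               ≡⟨ cong₂ _+_ (proj₁ (proj₂ last₁)) (incoming-R₁ h₁) ⟩
    1 + sendArrives (h₁ ↑ˡ b) R₂ R₁ (send (h₁ ↑ˡ b))               ≡⟨ cong suc (trans (sendArrives-target (h₁ ↑ˡ b) R₂ R₁) (when-yes (R₁ ≟ R₁) refl)) ⟩
    2                                                              ≡⟨ sym (cong spent (trans (σ-left h₁ R₁) left-final)) ⟩
    spent (σ (h₁ ↑ˡ b) R₁)                                         ∎
    where open ≡-Reasoning
  ... | no  i≢h₁ = begin
    tokens (i ↑ˡ b) R₁                                             ≡⟨ tokens-left i R₁ ≤-refl ⟩
    M₁.tokens i R₁ + incoming i R₁                                 ≡⟨ cong₂ _+_ (proj₂ (proj₂ last₁) i i≢h₁) (incoming-R₁ i) ⟩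
    0 + sendArrives (i ↑ˡ b) R₂ R₁ (send (h₁ ↑ˡ b))                ≡⟨ sendArrives-elsewhere (i ↑ˡ b) R₂ R₁ (h₁ ↑ˡ b) (i≢h₁ ∘ sym ∘ ↑ˡ-injective b h₁ i) ⟩
    0                                                              ≡⟨ sym (cong spent (trans (σ-left i R₁) (left-idle i R₁ ≤-refl (λ _ → i≢h₁)))) ⟩
    spent (σ (i ↑ˡ b) R₁)                                          ∎
    where open ≡-Reasoning

  arrivals-left-after : ∀ i t → R₁ < t → arrivals (i ↑ˡ b) t ≡ compArrives R₁ t (left i R₁)
  arrivals-left-after i t R₁<t = trans (arrivals-split (i ↑ˡ b) t) (cong₂ _+_ (cong₂ _+_ from-left (incoming-≢ i t (<⇒≢ R₁<t ∘ sym))) computed)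
    where
    to-left : ∀ u s → sendArrives (i ↑ˡ b) s t (left u s) ≡ 0
    to-left u s with left-shape u s
    ... | inj₁ (_ , _ , eq) = cong (sendArrives (i ↑ˡ b) s t) eq
    ... | inj₂ (_ , eq)     = trans (cong (sendArrives (i ↑ˡ b) s t) eq)
                                    (trans (L.sendArrives-relabel i s t (σ₁ u s)) (S₁.sendArrives-after i u s t R₁<t))
    from-left : sumFin a (λ u → sumBelow t (λ s → sendArrives (i ↑ˡ b) s t (left u s))) ≡ 0
    from-left = sumFin-zero a (λ u → sumBelow-zero t (λ s _ → to-left u s))
    computes : ∀ s → s ≢ R₁ → compArrives s t (σ (i ↑ˡ b) s) ≡ 0
    computes s s≢R₁ = trans (cong (compArrives s t) (trans (σ-left i s) (left-ordinary i s (⊥-elim ∘ s≢R₁))))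
                            (trans (L.compArrives-relabel s t (σ₁ i s)) (S₁.compArrives-after i s t R₁<t))
    computed : sumBelow t (λ s → compArrives s t (σ (i ↑ˡ b) s)) ≡ compArrives R₁ t (left i R₁)
    computed = trans (sumBelow-single t R₁ R₁<t (λ s _ → computes s)) (cong (compArrives R₁ t) (σ-left i R₁))

  tokens-left-after : ∀ i t → R₁ < t → t ≤ R → tokens (i ↑ˡ b) t ≡ compArrives R₁ t (left i R₁)
  tokens-left-after i (suc t) R₁<1+t 1+t≤R = trans (cong (_+ arrivals (i ↑ˡ b) (suc t)) nothing-kept) (arrivals-left-after i (suc t) R₁<1+t)
    where
    nothing-kept : tokens (i ↑ˡ b) t ∸ spent (σ (i ↑ˡ b) t) ≡ 0
    nothing-kept with m≤n⇒m<n∨m≡n (≤-pred R₁<1+t)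
    ... | inj₂ refl = trans (cong (_∸ spent (σ (i ↑ˡ b) t)) (left-at-R₁ i)) (n∸n≡0 (spent (σ (i ↑ˡ b) t)))
    ... | inj₁ R₁<t = trans (cong (_∸ spent (σ (i ↑ˡ b) t))
                              (trans (tokens-left-after i t R₁<t (<⇒≤ 1+t≤R))
                                     (compArrives-≢ R₁ t (left i R₁) (λ _ → <⇒≢ 1+t≤R ∘ sym))))
                            (0∸n≡0 (spent (σ (i ↑ˡ b) t)))

  neighbour : ∀ v t w → σ v t ≡ send w → w ≢ v
  neighbour v t w eq with side a b v
  neighbour _ t w eq | onLeft i with left-shape i t
  ... | inj₁ (_ , _ , final) with () ← trans (sym eq) (trans (σ-left i t) final)
  ... | inj₂ (_ , ordinary) with relabel-send (_↑ˡ b) (σ₁ i t) (trans (sym ordinary) (trans (sym (σ-left i t)) eq))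
  ...   | w₀ , sent , refl = V₁.neighbour i t w₀ sent ∘ ↑ˡ-injective b w₀ i
  neighbour _ t w eq | onRight j with right-shape j t
  ... | inj₁ (_ , _ , final) with refl ← trans (sym eq) (trans (σ-right j t) final) = ↑ˡ≢↑ʳ h₁ j
  ... | inj₂ (_ , ordinary) with relabel-send (a ↑ʳ_) (σ₂ j t) (trans (sym ordinary) (trans (sym (σ-right j t)) eq))
  ...   | w₀ , sent , refl = V₂.neighbour j t w₀ sent ∘ ↑ʳ-injective a w₀ j

  idle-enough : ∀ v t → σ v t ≡ idle → spent (σ v t) ≤ tokens v t
  idle-enough v t eq = subst (λ x → spent x ≤ tokens v t) (sym eq) z≤n

  enough : ∀ v t → spent (σ v t) ≤ tokens v t
  enough v t with side a b v
  enough _ t | onLeft i with <-cmp t R₁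
  ... | tri< t<R₁ _ _ = subst₂ _≤_ (sym (trans (cong spent (left-before i t t<R₁)) (L.spent-relabel (σ₁ i t))))
                                   (sym (tokens-left i t (<⇒≤ t<R₁)))
                                   (≤-trans (V₁.enough i t) (m≤m+n _ _))
  ... | tri≈ _ refl _ = ≤-reflexive (sym (left-at-R₁ i))
  ... | tri> _ _ R₁<t = idle-enough (i ↑ˡ b) t (trans (σ-left i t) (left-idle i t (<⇒≤ R₁<t) (⊥-elim ∘ <⇒≢ R₁<t ∘ sym)))
  enough _ t | onRight j with <-cmp t R₂
  ... | tri< t<R₂ _ _ = subst₂ _≤_ (sym (trans (cong spent (right-before j t t<R₂)) (Rt.spent-relabel (σ₂ j t))))
                                   (sym (tokens-right j t (<⇒≤ t<R₂)))
                                   (V₂.enough j t)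
  ... | tri> _ _ R₂<t = idle-enough (a ↑ʳ j) t (trans (σ-right j t) (right-idle j t (<⇒≤ R₂<t) (⊥-elim ∘ <⇒≢ R₂<t ∘ sym)))
  ... | tri≈ _ refl _ with j ≟F h₂
  ...   | yes refl = subst₂ _≤_ (sym (cong spent (trans (σ-right h₂ R₂) right-final)))
                                (sym (trans (tokens-right h₂ R₂ ≤-refl) (proj₁ (proj₂ last₂)))) ≤-refl
  ...   | no  j≢h₂ = idle-enough (a ↑ʳ j) R₂ (trans (σ-right j R₂) (right-idle j R₂ ≤-refl (λ _ → j≢h₂)))

  left-active : ∀ {i s} → σ (i ↑ˡ b) s ≡ ↑L (σ₁ i s) → σ (i ↑ˡ b) s ≢ idle → σ₁ i s ≢ idle
  left-active lifted active = relabel-active (_↑ˡ b) (active ∘ trans lifted)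

  right-active : ∀ {j s} → σ (a ↑ʳ j) s ≡ ↑R (σ₂ j s) → σ (a ↑ʳ j) s ≢ idle → σ₂ j s ≢ idle
  right-active lifted active = relabel-active (a ↑ʳ_) (active ∘ trans lifted)

  left-ends : ∀ {i s t} → σ (i ↑ˡ b) s ≡ ↑L (σ₁ i s) → s + M₁.dur (σ₁ i s) ≤ t → s + dur (σ (i ↑ˡ b) s) ≤ t
  left-ends {i} {s} {t} lifted ≤t =
    subst (λ x → s + dur x ≤ t) (sym lifted) (subst (λ d → s + d ≤ t) (sym (L.dur-relabel (σ₁ i s))) ≤t)

  right-ends : ∀ {j s t} → σ (a ↑ʳ j) s ≡ ↑R (σ₂ j s) → s + M₂.dur (σ₂ j s) ≤ t → s + dur (σ (a ↑ʳ j) s) ≤ t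
  right-ends {j} {s} {t} lifted ≤t =
    subst (λ x → s + dur x ≤ t) (sym lifted) (subst (λ d → s + d ≤ t) (sym (Rt.dur-relabel (σ₂ j s))) ≤t)

  notBusy : ∀ v s t → s < t → σ v s ≢ idle → σ v t ≢ idle → s + dur (σ v s) ≤ t
  notBusy v s t s<t s-active t-active with side a b v
  notBusy _ s t s<t s-active t-active | onLeft i with <-cmp t R₁
  ... | tri> _ _ R₁<t = ⊥-elim (t-active (trans (σ-left i t) (left-idle i t (<⇒≤ R₁<t) (⊥-elim ∘ <⇒≢ R₁<t ∘ sym))))
  ... | tri≈ _ refl _ = left-ends s-lifted (V₁.finished i s (left-active s-lifted s-active))
    where
    s-lifted : σ (i ↑ˡ b) s ≡ ↑L (σ₁ i s)
    s-lifted = left-before i s s<t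
  ... | tri< t<R₁ _ _ = left-ends s-lifted (V₁.notBusy i s t s<t (left-active s-lifted s-active)
                                                                 (left-active (left-before i t t<R₁) t-active))
    where
    s-lifted : σ (i ↑ˡ b) s ≡ ↑L (σ₁ i s)
    s-lifted = left-before i s (<-trans s<t t<R₁)
  notBusy _ s t s<t s-active t-active | onRight j with <-cmp t R₂
  ... | tri> _ _ R₂<t = ⊥-elim (t-active (trans (σ-right j t) (right-idle j t (<⇒≤ R₂<t) (⊥-elim ∘ <⇒≢ R₂<t ∘ sym))))
  ... | tri≈ _ refl _ = right-ends s-lifted (V₂.finished j s (right-active s-lifted s-active))
    where
    s-lifted : σ (a ↑ʳ j) s ≡ ↑R (σ₂ j s)
    s-lifted = right-before j s s<t
  ... | tri< t<R₂ _ _ = right-ends s-lifted (V₂.notBusy j s t s<t (right-active s-lifted s-active)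
                                                                  (right-active (right-before j t t<R₂) t-active))
    where
    s-lifted : σ (a ↑ʳ j) s ≡ ↑R (σ₂ j s)
    s-lifted = right-before j s (<-trans s<t t<R₂)

  R₂<R₁ : R₂ < R₁
  R₂<R₁ = m<m+n R₂ 0<tm

  R₁<R : R₁ < R
  R₁<R = m<m+n R₁ 0<tc

  finished : ∀ v t → σ v t ≢ idle → t + dur (σ v t) ≤ R
  finished v t active with side a b v
  finished _ t active | onLeft i with left-shape i t
  ... | inj₁ (refl , _ , final) = ≤-reflexive (cong (λ x → R₁ + dur x) (trans (σ-left i R₁) final))
  ... | inj₂ (_ , ordinary) = left-ends lifted (≤-trans (V₁.finished i t (left-active lifted active)) (<⇒≤ R₁<R))
    where
    lifted : σ (i ↑ˡ b) t ≡ ↑L (σ₁ i t)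
    lifted = trans (σ-left i t) ordinary
  finished _ t active | onRight j with right-shape j t
  ... | inj₁ (refl , _ , final) = subst (λ x → R₂ + dur x ≤ R) (sym (trans (σ-right j R₂) final)) (<⇒≤ R₁<R)
  ... | inj₂ (_ , ordinary) = right-ends lifted (≤-trans (V₂.finished j t (right-active lifted active)) (<⇒≤ (<-trans R₂<R₁ R₁<R)))
    where
    lifted : σ (a ↑ʳ j) t ≡ ↑R (σ₂ j t)
    lifted = trans (σ-right j t) ordinary

  oneLeft : sumFin (a + b) (λ v → tokens v R) ≡ 1
  oneLeft = begin
    sumFin (a + b) (λ v → tokens v R)                                      ≡⟨ sumFin-++ a b _ ⟩
    sumFin a (λ i → tokens (i ↑ˡ b) R) + sumFin b (λ j → tokens (a ↑ʳ j) R) ≡⟨ cong₂ _+_ left-part right-part ⟩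
    1 + 0                                                                  ∎
    where
    open ≡-Reasoning
    right-part : sumFin b (λ j → tokens (a ↑ʳ j) R) ≡ 0
    right-part = sumFin-zero b (λ j → tokens-right-after j R (<-trans R₂<R₁ R₁<R))
    left-part : sumFin a (λ i → tokens (i ↑ˡ b) R) ≡ 1
    left-part = begin
      sumFin a (λ i → tokens (i ↑ˡ b) R)                ≡⟨ sumFin-cong a (λ i → tokens-left-after i R R₁<R ≤-refl) ⟩
      sumFin a (λ i → compArrives R₁ R (left i R₁))      ≡⟨ sumFin-single a _ h₁ (λ i i≢h₁ → cong (compArrives R₁ R) (left-idle i R₁ ≤-refl (λ _ → i≢h₁))) ⟩
      compArrives R₁ R (left h₁ R₁)                      ≡⟨ cong (compArrives R₁ R) left-final ⟩
      compArrives R₁ R comp                              ≡⟨ compArrives-≡ R₁ R refl ⟩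
      1                                                  ∎

  valid : Valid R
  valid = record { neighbour = neighbour ; enough = enough ; notBusy = notBusy ; finished = finished ; oneLeft = oneLeft }

glue : ∀ tc tm → 0 < tc → 0 < tm → ∀ {a b} R₂ →
       Solvable tc tm a (R₂ + tm) → Solvable tc tm b R₂ → Solvable tc tm (a + b) (R₂ + tm + tc)
glue tc tm 0<tc 0<tm R₂ (σ₁ , V₁) (σ₂ , V₂) = σ , valid
  where open Glue tc tm 0<tc 0<tm σ₁ σ₂ R₂ V₁ V₂

lower-bound : ∀ tc tm (0<tc : 0 < tc) → 0 < tm → ∀ R → Solvable tc tm (Growth.F tc tm 0<tc R) R
lower-bound tc tm 0<tc 0<tm = <-rec _ solve
  where
  open Growth tc tm 0<tc
  solve : ∀ R → WfRec _<_ (λ R → Solvable tc tm (F R) R) R → Solvable tc tm (F R) R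
  solve R IH with tc + tm ≤? R
  ... | no  ≰  = subst (λ n → Solvable tc tm n R) (sym (F-base R (≰⇒> ≰))) (single-node tc tm R)
  ... | yes le = subst₂ (Solvable tc tm) (sym (F-rec R le)) R₂+tm+tc≡R
                   (glue tc tm 0<tc 0<tm R₂ (subst (Solvable tc tm (F (R ∸ tc))) (sym R₂+tm≡R∸tc) (IH (tc+tm≤⇒∸tc< le)))
                                           (IH (tc+tm≤⇒∸tc∸tm< le)))
    where
    R₂ : ℕ
    R₂ = R ∸ tc ∸ tm
    R₂+tm≡R∸tc : R₂ + tm ≡ R ∸ tc
    R₂+tm≡R∸tc = m∸n+n≡m (m+n≤o⇒m≤o∸n tm (subst (_≤ R) (+-comm tc tm) le))
    R₂+tm+tc≡R : R₂ + tm + tc ≡ R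
    R₂+tm+tc≡R = trans (cong (_+ tc) R₂+tm≡R∸tc) (m∸n+n≡m (≤-trans (m≤m+n tc tm) le))

lemma5 : (tc tm : ℕ) → 0 < tc → tc < tm → tc ∣ tm →
         (R : ℕ) → tc + tm ≤ R →
         ∃[ a ] ∃[ b ] (IsNStar tc tm (R ∸ tc) a
                      × IsNStar tc tm (R ∸ tc ∸ tm) b
                      × IsNStar tc tm R (a + b))
lemma5 tc tm 0<tc tc<tm _ R tc+tm≤R =
  F (R ∸ tc) , F (R ∸ tc ∸ tm) , optimal (R ∸ tc) , optimal (R ∸ tc ∸ tm) ,
  subst (IsNStar tc tm R) (F-rec R tc+tm≤R) (optimal R)
  where
  open Growth tc tm 0<tc
  optimal : ∀ R → IsNStar tc tm R (F R)
  optimal R = lower-bound tc tm 0<tc (<-trans 0<tc tc<tm) R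
            , λ m → upper-bound tc tm 0<tc (≤-<-trans 0<tc tc<tm) m R
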